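{- Let $k\ge 2$ and $c$ be integers, let $p$ be a prime and $\alpha\ge 1$ an integer. For $m\ge 2$ let $\mathbb{Z}_m^{\ast\ast}=\{a\in\mathbb{Z}_m:\gcd(a,m)=1\text{ and }\gcd(a-1,m)=1\}$ and $$\varphi_k(m,c)=\#\{(x_1,\dots,x_k)\in(\mathbb{Z}_m^{\ast\ast})^k:\ x_1+\cdots+x_k\equiv c \pmod m\}.$$ Then $\varphi_k(p^{\alpha},c)=p^{(k-1)(\alpha-1)}\varphi_k(p,c)$.
   Context: $\mathbb{Z}_m$ denotes the ring of residue classes modulo $m$; $\mathbb{Z}_m^{\ast\ast}$ is its set of exceptional units (units $u$ such that $1-u$ is also a unit). -}

module Defs where

open import Data.Nat as ℕ using (ℕ; zero; suc; NonZero)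
open import Data.Integer as ℤ using (ℤ; +_; _-_; _%ℕ_)
open import Data.Integer.GCD using (gcd)
open import Data.Fin using (Fin; toℕ)
open import Data.Vec using (Vec; []; _∷_; foldr)
open import Data.List using (List; []; _∷_; map; concatMap; allFin; filter; length)
open import Data.Product using (_×_)
open import Relation.Binary.PropositionalEquality using (_≡_)
open import Relation.Nullary using (Dec)
open import Relation.Nullary.Decidable using (_×-dec_)

-- A residue class of ℤ_m is represented by its canonical representative a ∈ {0,…,m-1}.
-- Exceptional unit: gcd(a, m) = 1 and gcd(a - 1, m) = 1 (gcd on ℤ, as in the paper).
IsExceptional : (m : ℕ) → Fin m → Set
IsExceptional m a =
  (gcd (+ toℕ a) (+ m) ≡ + 1) × (gcd ((+ toℕ a) - + 1) (+ m) ≡ + 1)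

isExceptional? : (m : ℕ) → (a : Fin m) → Dec (IsExceptional m a)
isExceptional? m a =
  (gcd (+ toℕ a) (+ m) ℤ.≟ + 1) ×-dec (gcd ((+ toℕ a) - + 1) (+ m) ℤ.≟ + 1)

exceptionalTuples : (m k : ℕ) → List (Vec (Fin m) k)
exceptionalTuples m zero    = [] ∷ []
exceptionalTuples m (suc k) =
  concatMap (λ a → map (a ∷_) (exceptionalTuples m k))
            (filter (isExceptional? m) (allFin m))

sumRep : {m k : ℕ} → Vec (Fin m) k → ℤ
sumRep = foldr _ (λ a s → (+ toℕ a) ℤ.+ s) (+ 0)

SumCong : (m : ℕ) .{{_ : NonZero m}} (c : ℤ) {k : ℕ} → Vec (Fin m) k → Set
SumCong m c xs = ((sumRep xs - c) %ℕ m) ≡ 0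

sumCong? : (m : ℕ) .{{_ : NonZero m}} (c : ℤ) {k : ℕ} → (xs : Vec (Fin m) k) → Dec (SumCong m c xs)
sumCong? m c xs = ((sumRep xs - c) %ℕ m) ℕ.≟ 0

φ : (k m : ℕ) .{{_ : NonZero m}} → ℤ → ℕ
φ k m c = length (filter (sumCong? m c) (exceptionalTuples m k))

-- Removing the first coordinate of a tuple gives
--   φ_{k+1}(m, c) = Σ_{i<m} [i ∈ ℤ_m^**] · φ_k(m, c − i),
-- and φ_k(m, c) depends only on c mod m. A residue is an exceptional unit modulo p^α (α ≥ 1)
-- iff it is one modulo p, so for m = p^α the summand is p-periodic in i and the sum over
-- i < p^α is p^(α−1) times the sum over i < p. Induction on k, starting from
-- φ_1(m, c) = [c ∈ ℤ_m^**], yields the factor p^((α−1)(k−1)).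
module Submission where

open import Defs
open import Data.Nat using (ℕ; _≤_; _*_; _^_; _∸_; NonZero)
open import Data.Nat.Primality using (Prime)
open import Data.Integer using (ℤ)
open import Relation.Binary.PropositionalEquality using (_≡_)

open import Data.Bool.Base using (true; false; if_then_else_)
open import Data.Fin.Base using (Fin; toℕ)
open import Data.Integer.Base as ℤ using (+_; _-_; _%ℕ_; ∣_∣)
open import Data.Integer.DivMod using (a≡a%ℕn+[a/ℕn]*n; n%ℕd<d)
open import Data.Integer.Divisibility.Signed using (_∣_; divides; ∣⇒∣ᵤ; ∣ᵤ⇒∣; ∣m⇒∣-m; ∣m∣n⇒∣m+n; ∣-trans)
open import Data.Integer.GCD using (gcd)
import Data.Integer.Properties as ℤ
open import Data.Integer.Tactic.RingSolver using (solve-∀)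
open import Data.List.Base using (List; []; _∷_; _++_; map; filter; concatMap; length; allFin; tabulate)
import Data.List.Properties as List
open import Data.Nat.Base as ℕ using (zero; suc; _<_; s≤s)
open import Data.Nat.Coprimality as Coprime using (Coprime; coprime-divisor; coprime⇒gcd≡1; gcd≡1⇒coprime)
open import Data.Nat.Divisibility as ℕ using (_∤_; >⇒∤)
open import Data.Nat.ListAction using (sum)
open import Data.Nat.Primality using (prime⇒irreducible; ¬prime[1])
import Data.Nat.Properties as ℕ
open import Data.Product.Base using (_×_; _,_)
open import Data.Product.Function.NonDependent.Propositional using (_×-⇔_)
open import Data.Sum.Base using (_⊎_; inj₁; inj₂)
open import Data.Vec.Base using (Vec; []; _∷_)
open import Function.Base using (_∘_)
open import Function.Bundles using (_⇔_; mk⇔; Equivalence)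
open import Function.Construct.Composition using (_⇔-∘_)
open import Function.Construct.Symmetry using (⇔-sym)
open import Level using (Level)
open import Relation.Binary.PropositionalEquality using (_≢_; refl; sym; trans; cong; cong₂; subst; module ≡-Reasoning)
open import Relation.Nullary using (Dec; does; ¬_; contradiction; yes; no)
open import Relation.Nullary.Decidable using (_×-dec_; does-⇔)
open import Relation.Unary using (Pred; Decidable)
open import Algebra.Properties.CommutativeSemigroup ℕ.*-commutativeSemigroup using (x∙yz≈y∙xz)

m∣n∧n<m⇒n≡0 : ∀ {m n} → m ℕ.∣ n → n < m → n ≡ 0
m∣n∧n<m⇒n≡0 {n = zero}  _   _   = refl
m∣n∧n<m⇒n≡0 {n = suc _} m∣n n<m = contradiction m∣n (>⇒∤ n<m)

-- A proof of x ≡ y mod m does not determine x and y, so lemmas about it take them explicitly.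
infix 4 _≡_mod_
_≡_mod_ : ℤ → ℤ → ℕ → Set
x ≡ y mod m = + m ∣ x - y

≡mod-sym : ∀ {m} x y → x ≡ y mod m → y ≡ x mod m
≡mod-sym {m} x y = subst (+ m ∣_) (neg-diff x y) ∘ ∣m⇒∣-m
  where
  neg-diff : ∀ x y → ℤ.- (x - y) ≡ y - x
  neg-diff = solve-∀

≡mod-trans : ∀ {m} x y z → x ≡ y mod m → y ≡ z mod m → x ≡ z mod m
≡mod-trans {m} x y z x≡y y≡z =
  subst (+ m ∣_) (ℤ.+-minus-telescope x y z) (∣m∣n⇒∣m+n x≡y y≡z)

≡mod-%ℕ : ∀ m .{{_ : NonZero m}} x → x ≡ + (x %ℕ m) mod m
≡mod-%ℕ m x = divides (x ℤ./ℕ m) (begin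
  x - + r                  ≡⟨ cong (_- + r) (a≡a%ℕn+[a/ℕn]*n x m) ⟩
  + r ℤ.+ q ℤ.* + m - + r  ≡⟨ cancel (+ r) (q ℤ.* + m) ⟩
  q ℤ.* + m                ∎)
  where
  open ≡-Reasoning
  r : ℕ
  r = x %ℕ m
  q : ℤ
  q = x ℤ./ℕ m
  cancel : ∀ r s → r ℤ.+ s - r ≡ s
  cancel = solve-∀

≡mod∧<⇒≡ : ∀ {m i j} → i < m → j < m → + i ≡ + j mod m → i ≡ j
≡mod∧<⇒≡ {m} {i} {j} i<m j<m i≡j = ℤ.+-injective (ℤ.i-j≡0⇒i≡j (+ i) (+ j) (ℤ.∣i∣≡0⇒i≡0 distance≡0))
  where
  distance<m : ∣ + i - + j ∣ < m
  distance<m = ℕ.≤-<-trans (ℕ.≤-reflexive (cong ∣_∣ (ℤ.[+m]-[+n]≡m⊖n i j)))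
                           (ℕ.≤-<-trans (ℤ.∣m⊝n∣≤m⊔n i j) (ℕ.⊔-lub i<m j<m))
  distance≡0 : ∣ + i - + j ∣ ≡ 0
  distance≡0 = m∣n∧n<m⇒n≡0 (∣⇒∣ᵤ i≡j) distance<m

%ℕ≡0⇔∣ : ∀ m .{{_ : NonZero m}} x → x %ℕ m ≡ 0 ⇔ + m ∣ x
%ℕ≡0⇔∣ m x = mk⇔ to from
  where
  to : x %ℕ m ≡ 0 → + m ∣ x
  to r≡0 = subst (+ m ∣_) (ℤ.+-identityʳ x) (subst (λ r → x ≡ + r mod m) r≡0 (≡mod-%ℕ m x))
  from : + m ∣ x → x %ℕ m ≡ 0
  from m∣x = ≡mod∧<⇒≡ {m} (n%ℕd<d x m) (ℕ.>-nonZero⁻¹ m) r≡0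
    where
    r : ℕ
    r = x %ℕ m
    x≡0 : x ≡ + 0 mod m
    x≡0 = subst (+ m ∣_) (sym (ℤ.+-identityʳ x)) m∣x
    r≡0 : + r ≡ + 0 mod m
    r≡0 = ≡mod-trans (+ r) x (+ 0) (≡mod-sym x (+ r) (≡mod-%ℕ m x)) x≡0

0≡x-y⇔y≡x : ∀ {m} x y → + 0 ≡ x - y mod m ⇔ y ≡ x mod m
0≡x-y⇔y≡x {m} x y = mk⇔ (subst (+ m ∣_) (flip x y)) (subst (+ m ∣_) (sym (flip x y)))
  where
  flip : ∀ x y → + 0 - (x - y) ≡ y - x
  flip = solve-∀

n+i≡i-mod-n : ∀ n i → + (n ℕ.+ i) ≡ + i mod n
n+i≡i-mod-n n i = divides (+ 1) (begin
  + (n ℕ.+ i) - + i      ≡⟨ cong (_- + i) (ℤ.pos-+ n i) ⟩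
  + n ℤ.+ + i - + i      ≡⟨ cancel (+ n) (+ i) ⟩
  + 1 ℤ.* + n            ∎)
  where
  open ≡-Reasoning
  cancel : ∀ a b → a ℤ.+ b - b ≡ + 1 ℤ.* a
  cancel = solve-∀

prime∧∤⇒coprime : ∀ {p n} → Prime p → p ∤ n → Coprime p n
prime∧∤⇒coprime pr p∤n (d∣p , d∣n) with prime⇒irreducible pr d∣p
... | inj₁ d≡1    = d≡1
... | inj₂ refl   = contradiction d∣n p∤n

∣p^n⇒≡1⊎p∣ : ∀ {p d} → Prime p → ∀ n → d ℕ.∣ p ^ n → d ≡ 1 ⊎ p ℕ.∣ d
∣p^n⇒≡1⊎p∣ pr zero    d∣1 = inj₁ (ℕ.∣1⇒≡1 d∣1)
∣p^n⇒≡1⊎p∣ {p} {d} pr (suc n) d∣p^[1+n] with p ℕ.∣? d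
... | yes p∣d = inj₂ p∣d
... | no  p∤d = ∣p^n⇒≡1⊎p∣ pr n (coprime-divisor (Coprime.sym (prime∧∤⇒coprime pr p∤d)) d∣p^[1+n])

coprime-p^[1+n]⇔coprime-p : ∀ {p a} → Prime p → ∀ n → Coprime a (p ^ suc n) ⇔ Coprime a p
coprime-p^[1+n]⇔coprime-p {p} {a} pr n = mk⇔ to from
  where
  to : Coprime a (p ^ suc n) → Coprime a p
  to coprime (d∣a , d∣p) = coprime (d∣a , ℕ.∣-trans d∣p (ℕ.m∣m*n (p ^ n)))
  from : Coprime a p → Coprime a (p ^ suc n)
  from coprime (d∣a , d∣p^[1+n]) with ∣p^n⇒≡1⊎p∣ pr (suc n) d∣p^[1+n]
  ... | inj₁ d≡1 = d≡1
  ... | inj₂ p∣d = contradiction (subst Prime (coprime (ℕ.∣-trans p∣d d∣a , ℕ.∣-refl)) pr) ¬prime[1]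

gcd≡1⇔coprime : ∀ x m → gcd x (+ m) ≡ + 1 ⇔ Coprime ∣ x ∣ m
gcd≡1⇔coprime x m = mk⇔ (gcd≡1⇒coprime ∘ ℤ.+-injective) (cong +_ ∘ coprime⇒gcd≡1)

gcd≡1-resp-≡mod : ∀ {m} x y → x ≡ y mod m → gcd x (+ m) ≡ + 1 → gcd y (+ m) ≡ + 1
gcd≡1-resp-≡mod {m} x y x≡y gcd≡1 = Equivalence.from (gcd≡1⇔coprime y m) coprime-y
  where
  coprime-y : Coprime ∣ y ∣ m
  coprime-y {d} (d∣y , d∣m) = Equivalence.to (gcd≡1⇔coprime x m) gcd≡1 (∣⇒∣ᵤ d∣x , d∣m)
    where
    split : ∀ x y → x ≡ (x - y) ℤ.+ y
    split = solve-∀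
    d∣x : + d ∣ x
    d∣x = subst (+ d ∣_) (sym (split x y)) (∣m∣n⇒∣m+n (∣-trans (∣ᵤ⇒∣ d∣m) x≡y) (∣ᵤ⇒∣ d∣y))

-- At x = + toℕ a these are definitionally IsExceptional m a and isExceptional? m a.
Exceptional : ℕ → ℤ → Set
Exceptional m x = gcd x (+ m) ≡ + 1 × gcd (x - + 1) (+ m) ≡ + 1

exceptional? : ∀ m x → Dec (Exceptional m x)
exceptional? m x = (gcd x (+ m) ℤ.≟ + 1) ×-dec (gcd (x - + 1) (+ m) ℤ.≟ + 1)

exceptional-resp-≡mod : ∀ {m} x y → x ≡ y mod m → Exceptional m x → Exceptional m y
exceptional-resp-≡mod {m} x y x≡y (unit-x , unit-x-1) =
  gcd≡1-resp-≡mod x y x≡y unit-x , gcd≡1-resp-≡mod (x - + 1) (y - + 1) x-1≡y-1 unit-x-1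
  where
  shift : ∀ x y → x - y ≡ (x - + 1) - (y - + 1)
  shift = solve-∀
  x-1≡y-1 : x - + 1 ≡ y - + 1 mod m
  x-1≡y-1 = subst (+ m ∣_) (shift x y) x≡y

exceptional-p^[1+n]⇔exceptional-p : ∀ {p} → Prime p → ∀ n x → Exceptional (p ^ suc n) x ⇔ Exceptional p x
exceptional-p^[1+n]⇔exceptional-p {p} pr n x = unit-lift x ×-⇔ unit-lift (x - + 1)
  where
  unit-lift : ∀ y → gcd y (+ (p ^ suc n)) ≡ + 1 ⇔ gcd y (+ p) ≡ + 1
  unit-lift y = ⇔-sym (gcd≡1⇔coprime y p) ⇔-∘ (coprime-p^[1+n]⇔coprime-p pr n ⇔-∘ gcd≡1⇔coprime y (p ^ suc n))

sumBelow : ℕ → (ℕ → ℕ) → ℕ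
sumBelow zero    f = 0
sumBelow (suc n) f = f 0 ℕ.+ sumBelow n (f ∘ suc)

syntax sumBelow n (λ i → e) = ∑[ i < n ] e

∑-cong : ∀ n {f g : ℕ → ℕ} → (∀ i → f i ≡ g i) → sumBelow n f ≡ sumBelow n g
∑-cong zero    f≡g = refl
∑-cong (suc n) f≡g = cong₂ ℕ._+_ (f≡g 0) (∑-cong n (f≡g ∘ suc))

∑-zero : ∀ n {f : ℕ → ℕ} → (∀ {i} → i < n → f i ≡ 0) → sumBelow n f ≡ 0
∑-zero zero    f≡0 = refl
∑-zero (suc n) f≡0 = cong₂ ℕ._+_ (f≡0 ℕ.z<s) (∑-zero n (f≡0 ∘ s≤s))

∑-delta : ∀ {n r} (f : ℕ → ℕ) → r < n → (∀ {i} → i < n → i ≢ r → f i ≡ 0) → sumBelow n f ≡ f r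
∑-delta {suc n} {zero} f _ f≡0 = begin
  f 0 ℕ.+ sumBelow n (f ∘ suc)  ≡⟨ cong (f 0 ℕ.+_) (∑-zero n (λ i<n → f≡0 (s≤s i<n) λ ())) ⟩
  f 0 ℕ.+ 0                     ≡⟨ ℕ.+-identityʳ (f 0) ⟩
  f 0                           ∎
  where open ≡-Reasoning
∑-delta {suc n} {suc r} f (s≤s r<n) f≡0 =
  cong₂ ℕ._+_ (f≡0 ℕ.z<s λ ()) (∑-delta (f ∘ suc) r<n λ i<n i≢r → f≡0 (s≤s i<n) (i≢r ∘ ℕ.suc-injective))

∑-+ : ∀ m n (f : ℕ → ℕ) → sumBelow (m ℕ.+ n) f ≡ sumBelow m f ℕ.+ sumBelow n (λ i → f (m ℕ.+ i))
∑-+ zero    n f = refl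
∑-+ (suc m) n f = trans (cong (f 0 ℕ.+_) (∑-+ m n (f ∘ suc))) (sym (ℕ.+-assoc (f 0) _ _))

∑-periodic : ∀ n q (f : ℕ → ℕ) → (∀ i → f (n ℕ.+ i) ≡ f i) → sumBelow (q * n) f ≡ q * sumBelow n f
∑-periodic n zero    f periodic = refl
∑-periodic n (suc q) f periodic = begin
  sumBelow (n ℕ.+ q * n) f                                    ≡⟨ ∑-+ n (q * n) f ⟩
  sumBelow n f ℕ.+ sumBelow (q * n) (λ i → f (n ℕ.+ i))      ≡⟨ cong (sumBelow n f ℕ.+_) (∑-cong (q * n) periodic) ⟩
  sumBelow n f ℕ.+ sumBelow (q * n) f                         ≡⟨ cong (sumBelow n f ℕ.+_) (∑-periodic n q f periodic) ⟩
  sumBelow n f ℕ.+ q * sumBelow n f                           ∎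
  where open ≡-Reasoning

*-distribˡ-∑ : ∀ a n (f : ℕ → ℕ) → a * sumBelow n f ≡ ∑[ i < n ] (a * f i)
*-distribˡ-∑ a zero    f = ℕ.*-zeroʳ a
*-distribˡ-∑ a (suc n) f = trans (ℕ.*-distribˡ-+ a (f 0) _) (cong (a * f 0 ℕ.+_) (*-distribˡ-∑ a n (f ∘ suc)))

sum-map-allFin : ∀ n (f : ℕ → ℕ) → sum (map (f ∘ toℕ) (allFin n)) ≡ sumBelow n f
sum-map-allFin n f = trans (cong sum (List.map-tabulate {n = n} (λ i → i) (f ∘ toℕ))) (sum-tabulate n f)
  where
  sum-tabulate : ∀ n (f : ℕ → ℕ) → sum (tabulate {n = n} (f ∘ toℕ)) ≡ sumBelow n f
  sum-tabulate zero    f = refl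
  sum-tabulate (suc n) f = cong (f 0 ℕ.+_) (sum-tabulate n (f ∘ suc))

𝟙 : ∀ {a} {P : Set a} → Dec P → ℕ
𝟙 P? = if does P? then 1 else 0

𝟙-⇔ : ∀ {a b} {P : Set a} {Q : Set b} → P ⇔ Q → (P? : Dec P) (Q? : Dec Q) → 𝟙 P? ≡ 𝟙 Q?
𝟙-⇔ P⇔Q P? Q? = cong (if_then 1 else 0) (does-⇔ P⇔Q P? Q?)

module _ {a p : Level} {A : Set a} {P : Pred A p} (P? : Decidable P) where

  sum-map-filter : ∀ (f : A → ℕ) xs → sum (map f (filter P? xs)) ≡ sum (map (λ x → 𝟙 (P? x) * f x) xs)
  sum-map-filter f []       = refl
  sum-map-filter f (x ∷ xs) with does (P? x)
  ... | true  = cong₂ ℕ._+_ (sym (ℕ.*-identityˡ (f x))) (sum-map-filter f xs)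
  ... | false = sum-map-filter f xs

  length-filter-concatMap : ∀ {b} {B : Set b} (f : B → List A) xs →
    length (filter P? (concatMap f xs)) ≡ sum (map (length ∘ filter P? ∘ f) xs)
  length-filter-concatMap f []       = refl
  length-filter-concatMap f (x ∷ xs) = begin
    length (filter P? (f x ++ concatMap f xs))
      ≡⟨ cong length (List.filter-++ P? (f x) _) ⟩
    length (filter P? (f x) ++ filter P? (concatMap f xs))
      ≡⟨ List.length-++ (filter P? (f x)) ⟩
    length (filter P? (f x)) ℕ.+ length (filter P? (concatMap f xs))
      ≡⟨ cong (length (filter P? (f x)) ℕ.+_) (length-filter-concatMap f xs) ⟩
    length (filter P? (f x)) ℕ.+ sum (map (length ∘ filter P? ∘ f) xs)
      ∎
    where open ≡-Reasoning

  length-filter-⇔ : ∀ {q} {Q : Pred A q} (Q? : Decidable Q) → (∀ x → P x ⇔ Q x) →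
                    ∀ xs → length (filter P? xs) ≡ length (filter Q? xs)
  length-filter-⇔ Q? P⇔Q = cong length ∘ List.filter-≐ P? Q?
    ((λ {x} → Equivalence.to (P⇔Q x)) , (λ {x} → Equivalence.from (P⇔Q x)))

  length-filter-map : ∀ {b} {B : Set b} (g : B → A) xs → length (filter P? (map g xs)) ≡ length (filter (P? ∘ g) xs)
  length-filter-map g []       = refl
  length-filter-map g (x ∷ xs) with does (P? (g x))
  ... | true  = cong suc (length-filter-map g xs)
  ... | false = length-filter-map g xs

𝟙-exceptional-resp-≡mod : ∀ {m} x y → x ≡ y mod m → 𝟙 (exceptional? m x) ≡ 𝟙 (exceptional? m y)
𝟙-exceptional-resp-≡mod {m} x y x≡y = 𝟙-⇔
  (mk⇔ (exceptional-resp-≡mod x y x≡y) (exceptional-resp-≡mod y x (≡mod-sym x y x≡y)))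
  (exceptional? m x) (exceptional? m y)

module _ (m : ℕ) .{{_ : NonZero m}} where

  sumCong⇔≡mod : ∀ c {k} (xs : Vec (Fin m) k) → SumCong m c xs ⇔ sumRep xs ≡ c mod m
  sumCong⇔≡mod c xs = %ℕ≡0⇔∣ m (sumRep xs - c)

  sumCong-∷⇔ : ∀ c {k} a (xs : Vec (Fin m) k) → SumCong m c (a ∷ xs) ⇔ SumCong m (c - + toℕ a) xs
  sumCong-∷⇔ c a xs = mk⇔ (subst (λ z → z %ℕ m ≡ 0) (regroup (+ toℕ a) (sumRep xs) c))
                          (subst (λ z → z %ℕ m ≡ 0) (sym (regroup (+ toℕ a) (sumRep xs) c)))
    where
    regroup : ∀ a s c → a ℤ.+ s - c ≡ s - (c - a)
    regroup = solve-∀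

  φ-cong : ∀ k c c′ → c ≡ c′ mod m → φ k m c ≡ φ k m c′
  φ-cong k c c′ c≡c′ = length-filter-⇔ (sumCong? m c) (sumCong? m c′) same-residue (exceptionalTuples m k)
    where
    same-target : ∀ s → s ≡ c mod m ⇔ s ≡ c′ mod m
    same-target s = mk⇔ (λ s≡c → ≡mod-trans s c c′ s≡c c≡c′)
                        (λ s≡c′ → ≡mod-trans s c′ c s≡c′ (≡mod-sym c c′ c≡c′))
    same-residue : ∀ xs → SumCong m c xs ⇔ SumCong m c′ xs
    same-residue xs = ⇔-sym (sumCong⇔≡mod c′ xs) ⇔-∘ (same-target (sumRep xs) ⇔-∘ sumCong⇔≡mod c xs)

  φ-zero-≡ : ∀ c → + 0 ≡ c mod m → φ 0 m c ≡ 1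
  φ-zero-≡ c 0≡c = cong length
    (List.filter-accept (sumCong? m c) {x = []} {xs = []} (Equivalence.from (sumCong⇔≡mod c []) 0≡c))

  φ-zero-≢ : ∀ c → ¬ (+ 0 ≡ c mod m) → φ 0 m c ≡ 0
  φ-zero-≢ c 0≢c = cong length
    (List.filter-reject (sumCong? m c) {x = []} {xs = []} (0≢c ∘ Equivalence.to (sumCong⇔≡mod c [])))

  φ-suc : ∀ k c → φ (suc k) m c ≡ ∑[ i < m ] (𝟙 (exceptional? m (+ i)) * φ k m (c - + i))
  φ-suc k c = begin
    φ (suc k) m c
      ≡⟨ length-filter-concatMap (sumCong? m c) prepend (filter (isExceptional? m) (allFin m)) ⟩
    sum (map (length ∘ filter (sumCong? m c) ∘ prepend) (filter (isExceptional? m) (allFin m)))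
      ≡⟨ cong sum (List.map-cong count-prepend (filter (isExceptional? m) (allFin m))) ⟩
    sum (map (λ a → φ k m (c - + toℕ a)) (filter (isExceptional? m) (allFin m)))
      ≡⟨ sum-map-filter (isExceptional? m) (λ a → φ k m (c - + toℕ a)) (allFin m) ⟩
    sum (map (λ a → 𝟙 (isExceptional? m a) * φ k m (c - + toℕ a)) (allFin m))
      ≡⟨ sum-map-allFin m (λ i → 𝟙 (exceptional? m (+ i)) * φ k m (c - + i)) ⟩
    ∑[ i < m ] (𝟙 (exceptional? m (+ i)) * φ k m (c - + i))
      ∎
    where
    open ≡-Reasoning
    prepend : Fin m → List (Vec (Fin m) (suc k))
    prepend a = map (a ∷_) (exceptionalTuples m k)
    count-prepend : ∀ a → length (filter (sumCong? m c) (prepend a)) ≡ φ k m (c - + toℕ a)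
    count-prepend a = trans (length-filter-map (sumCong? m c) (a ∷_) (exceptionalTuples m k))
                            (length-filter-⇔ _ (sumCong? m (c - + toℕ a)) (sumCong-∷⇔ c a) (exceptionalTuples m k))

  φ-one : ∀ c → φ 1 m c ≡ 𝟙 (exceptional? m c)
  φ-one c = begin
    φ 1 m c                                                  ≡⟨ φ-suc 0 c ⟩
    ∑[ i < m ] (𝟙 (exceptional? m (+ i)) * φ 0 m (c - + i))  ≡⟨ ∑-delta _ (n%ℕd<d c m) off-residue ⟩
    𝟙 (exceptional? m (+ r)) * φ 0 m (c - + r)               ≡⟨ cong (𝟙 (exceptional? m (+ r)) *_) (φ-zero-≡ (c - + r) 0≡c-r) ⟩
    𝟙 (exceptional? m (+ r)) * 1                             ≡⟨ ℕ.*-identityʳ _ ⟩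
    𝟙 (exceptional? m (+ r))                                 ≡⟨ 𝟙-exceptional-resp-≡mod (+ r) c r≡c ⟩
    𝟙 (exceptional? m c)                                     ∎
    where
    open ≡-Reasoning
    r : ℕ
    r = c %ℕ m
    r≡c : + r ≡ c mod m
    r≡c = ≡mod-sym c (+ r) (≡mod-%ℕ m c)
    0≡c-r : + 0 ≡ c - + r mod m
    0≡c-r = Equivalence.from (0≡x-y⇔y≡x c (+ r)) r≡c
    off-residue : ∀ {i} → i < m → i ≢ r → 𝟙 (exceptional? m (+ i)) * φ 0 m (c - + i) ≡ 0
    off-residue {i} i<m i≢r =
      trans (cong (𝟙 (exceptional? m (+ i)) *_) (φ-zero-≢ (c - + i) 0≢c-i)) (ℕ.*-zeroʳ (𝟙 (exceptional? m (+ i))))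
      where
      0≢c-i : ¬ (+ 0 ≡ c - + i mod m)
      0≢c-i 0≡c-i = i≢r (≡mod∧<⇒≡ i<m (n%ℕd<d c m)
        (≡mod-trans (+ i) c (+ r) (Equivalence.to (0≡x-y⇔y≡x c (+ i)) 0≡c-i) (≡mod-%ℕ m c)))

module _ {m n q : ℕ} .{{_ : NonZero m}} .{{_ : NonZero n}} (m≡q*n : m ≡ q * n)
         (lift : ∀ x → Exceptional m x ⇔ Exceptional n x) where

  φ-lift : ∀ k c → φ (suc k) m c ≡ q ^ k * φ (suc k) n c
  φ-lift zero c = begin
    φ 1 m c                ≡⟨ φ-one m c ⟩
    𝟙 (exceptional? m c)   ≡⟨ 𝟙-⇔ (lift c) (exceptional? m c) (exceptional? n c) ⟩
    𝟙 (exceptional? n c)   ≡⟨ φ-one n c ⟨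
    φ 1 n c                ≡⟨ ℕ.*-identityˡ (φ 1 n c) ⟨
    1 * φ 1 n c            ∎
    where open ≡-Reasoning
  φ-lift (suc k) c = begin
    φ (2 ℕ.+ k) m c
      ≡⟨ φ-suc m (suc k) c ⟩
    ∑[ i < m ] (𝟙 (exceptional? m (+ i)) * φ (suc k) m (c - + i))
      ≡⟨ ∑-cong m lift-term ⟩
    ∑[ i < m ] (q ^ k * term i)
      ≡⟨ *-distribˡ-∑ (q ^ k) m term ⟨
    q ^ k * sumBelow m term
      ≡⟨ cong (λ l → q ^ k * sumBelow l term) m≡q*n ⟩
    q ^ k * sumBelow (q * n) term
      ≡⟨ cong (q ^ k *_) (∑-periodic n q term term-periodic) ⟩
    q ^ k * (q * sumBelow n term)
      ≡⟨ ℕ.*-assoc (q ^ k) q _ ⟨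
    q ^ k * q * sumBelow n term
      ≡⟨ cong₂ _*_ (ℕ.*-comm (q ^ k) q) (sym (φ-suc n (suc k) c)) ⟩
    q ^ suc k * φ (2 ℕ.+ k) n c
      ∎
    where
    open ≡-Reasoning
    term : ℕ → ℕ
    term i = 𝟙 (exceptional? n (+ i)) * φ (suc k) n (c - + i)
    lift-term : ∀ i → 𝟙 (exceptional? m (+ i)) * φ (suc k) m (c - + i) ≡ q ^ k * term i
    lift-term i = trans (cong₂ _*_ (𝟙-⇔ (lift (+ i)) (exceptional? m (+ i)) (exceptional? n (+ i)))
                                   (φ-lift k (c - + i)))
                        (x∙yz≈y∙xz (𝟙 (exceptional? n (+ i))) (q ^ k) (φ (suc k) n (c - + i)))
    term-periodic : ∀ i → term (n ℕ.+ i) ≡ term i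
    term-periodic i = cong₂ _*_ (𝟙-exceptional-resp-≡mod (+ (n ℕ.+ i)) (+ i) (n+i≡i-mod-n n i))
                                (φ-cong n (suc k) (c - + (n ℕ.+ i)) (c - + i) c-[n+i]≡c-i)
      where
      swap : ∀ c a b → b - a ≡ (c - a) - (c - b)
      swap = solve-∀
      c-[n+i]≡c-i : c - + (n ℕ.+ i) ≡ c - + i mod n
      c-[n+i]≡c-i = subst (+ n ∣_) (swap c (+ (n ℕ.+ i)) (+ i)) (≡mod-sym (+ (n ℕ.+ i)) (+ i) (n+i≡i-mod-n n i))

lemma2p2 : (k : ℕ) → 2 ≤ k → (c : ℤ) → (p : ℕ) → (pr : Prime p) → (α : ℕ) → 1 ≤ α →
    (nzp : NonZero p) → (nzpα : NonZero (p ^ α)) →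
      φ k (p ^ α) {{nzpα}} c ≡ p ^ ((k ∸ 1) * (α ∸ 1)) * φ k p {{nzp}} c
lemma2p2 (suc k) _ c p pr (suc β) _ nzp nzpα = begin
  φ (suc k) (p ^ suc β) c              ≡⟨ φ-lift (ℕ.*-comm p (p ^ β)) (exceptional-p^[1+n]⇔exceptional-p pr β) k c ⟩
  (p ^ β) ^ k * φ (suc k) p c          ≡⟨ cong (_* φ (suc k) p c) (ℕ.^-*-assoc p β k) ⟩
  p ^ (β * k) * φ (suc k) p c          ≡⟨ cong (λ e → p ^ e * φ (suc k) p c) (ℕ.*-comm β k) ⟩
  p ^ (k * β) * φ (suc k) p c          ∎
  where
  open ≡-Reasoning
  instance
    _ = nzp
    _ = nzpα
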